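{- Let $S$ be a string of length $n$, let $k\ge 1$ be an integer, and let $1\le x\le \frac{n}{2}$. Let $$\mathcal{I}=\left\{i\ \middle|\ 1\le i\le\frac{x}{4k+2},\ \mathrm{HAM}(S[1,x],S[i+1,i+x])\le k\right\}.$$ For any two $p,q\in\mathcal{I}$ with $p<q$, their greatest common divisor $d=\gcd(p,q)$ satisfies $$\mathrm{HAM}(S[1,x],S[d+1,d+x])\le 16k^2+1.$$
   Context: For a string $S=S[1]\cdots S[n]$, $S[i,j]$ denotes the substring $S[i]\cdots S[j]$, and for strings $A,B$ of equal length $\mathrm{HAM}(A,B)=|\{i:A[i]\neq B[i]\}|$ is their Hamming distance. -}

module Defs where

open import Data.Nat using (ℕ; zero; suc; _+_; _≤_; _<_)
open import Data.Nat.Properties using (+-monoʳ-<; ≤-trans; <-≤-trans)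
open import Data.Fin using (Fin; toℕ; fromℕ<)
open import Data.Fin.Properties using (toℕ<n)
open import Data.Vec using (Vec; []; _∷_; lookup; tabulate)
open import Relation.Nullary using (yes; no)
open import Relation.Binary.Definitions using (DecidableEquality)

HAM : {A : Set} → DecidableEquality A → {m : ℕ} → Vec A m → Vec A m → ℕ
HAM _≟_ []       []       = 0
HAM _≟_ (a ∷ as) (b ∷ bs) with a ≟ b
... | yes _ = HAM _≟_ as bs
... | no  _ = suc (HAM _≟_ as bs)

-- substr S i len h  is the (1-indexed) substring S[i+1, i+len] of S,
-- i.e. the length-len string starting right after position i.
substr : {A : Set} {n : ℕ} → Vec A n → (i len : ℕ) → i + len ≤ n → Vec A len
substr S i len h =
  tabulate (λ j → lookup S (fromℕ< (<-≤-trans (+-monoʳ-< i (toℕ<n j)) h)))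

-- Call a block of q consecutive positions of S[1,x] clean if none of its positions is a
-- mismatch of S against its shift by p or by q. There are at most 2k such mismatches, so any
-- K = 2k+1 consecutive blocks contain a clean one; on it S has periods p and q over a window of
-- length p + q, hence period d = gcd p q (weak Fine–Wilf, by subtractive Euclid), so S agrees
-- with its d-shift at the start y of the block. For a d-mismatch at j, choose such a y a
-- multiple of q away from j (after j if there is room, else before it, using x ≥ 2Kq): the walk
-- from j, or from d + j, to y in steps of q crosses a q-mismatch at distance c·q with c ≤ K.
-- For each c the positions charged this way form four shifted copies of the q-mismatches, so
-- there are at most (K + 1)·4k = (2k + 2)·4k ≤ 16k² + 1 of them.
module Submission where

open import Defs
open import Level using (Level)
open import Function using (_∘_; case_of_)
open import Data.Nat
open import Data.Nat.Properties
open import Data.Product using (∃; _×_; _,_; proj₁; proj₂)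
open import Data.Sum using (_⊎_; inj₁; inj₂)
open import Relation.Binary.PropositionalEquality
open import Relation.Nullary using (¬_; yes; no; contradiction; ¬?)
open import Relation.Binary.Definitions using (DecidableEquality)
open import Data.Fin using (toℕ; fromℕ<)
open import Data.Fin.Properties using (fromℕ<-cong; toℕ<n)
open import Data.Vec using (Vec; lookup; tabulate)
open import Data.Vec.Properties using (tabulate-cong)
open import Relation.Nullary.Decidable using (_×-dec_; decidable-stable)
open import Relation.Unary using (Pred; Decidable; _∪_)
open import Relation.Unary.Properties using (_∪?_)
open import Data.Nat.GCD using (gcd; gcd-GCD; gcd-comm; gcd-identityˡ; gcd-identityʳ)
import Data.Nat.GCD as GCD
open import Induction.WellFounded using (Acc; acc)
open import Data.Nat.Induction using (<-wellFounded)
open import Data.Nat.Divisibility using (∣⇒≤)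
open import Data.Nat.Tactic.RingSolver using (solve-∀)
open import Algebra.Properties.CommutativeSemigroup +-commutativeSemigroup using (x∙yz≈y∙xz)

private variable
  ℓ ℓ′ : Level
  P Q : Pred ℕ ℓ

count : Decidable P → ℕ → ℕ
count P? zero = 0
count P? (suc N) with P? 0
... | yes _ = suc (count (P? ∘ suc) N)
... | no  _ = count (P? ∘ suc) N

count-+ : (P? : Decidable P) → ∀ a b → count P? (a + b) ≡ count P? a + count (P? ∘ (a +_)) b
count-+ P? zero    b = refl
count-+ P? (suc a) b with P? 0
... | yes _ = cong suc (count-+ (P? ∘ suc) a b)
... | no  _ = count-+ (P? ∘ suc) a b

count-mono-⊆ : (P? : Decidable P) (Q? : Decidable Q) → ∀ N →
               (∀ {i} → i < N → P i → Q i) → count P? N ≤ count Q? N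
count-mono-⊆ P? Q? zero    P⊆Q = z≤n
count-mono-⊆ P? Q? (suc N) P⊆Q with P? 0 | Q? 0
... | yes P0 | no ¬Q0 = contradiction (P⊆Q z<s P0) ¬Q0
... | yes _  | yes _  = s≤s (count-mono-⊆ (P? ∘ suc) (Q? ∘ suc) N (P⊆Q ∘ s<s))
... | no _   | yes _  = m≤n⇒m≤1+n (count-mono-⊆ (P? ∘ suc) (Q? ∘ suc) N (P⊆Q ∘ s<s))
... | no _   | no _   = count-mono-⊆ (P? ∘ suc) (Q? ∘ suc) N (P⊆Q ∘ s<s)

count-none : (P? : Decidable P) → ∀ N → (∀ {i} → i < N → ¬ P i) → count P? N ≡ 0
count-none P? zero    ¬P = refl
count-none P? (suc N) ¬P with P? 0
... | yes P0 = contradiction P0 (¬P z<s)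
... | no  _  = count-none (P? ∘ suc) N (¬P ∘ s<s)

count≡0⇒none : (P? : Decidable P) → ∀ N → count P? N ≡ 0 → ∀ {i} → i < N → ¬ P i
count≡0⇒none P? (suc N) eq {i} i<N Pi with P? 0
count≡0⇒none P? (suc N) eq {zero}  _         P0 | no ¬P0 = ¬P0 P0
count≡0⇒none P? (suc N) eq {suc i} (s<s i<N) Pi | no _   = count≡0⇒none (P? ∘ suc) N eq i<N Pi

count-monoʳ-≤ : (P? : Decidable P) → ∀ {M N} → M ≤ N → count P? M ≤ count P? N
count-monoʳ-≤ P? {M} {N} M≤N = begin
  count P? M                                   ≤⟨ m≤m+n _ _ ⟩
  count P? M + count (P? ∘ (M +_)) (N ∸ M)     ≡⟨ count-+ P? M (N ∸ M) ⟨
  count P? (M + (N ∸ M))                       ≡⟨ cong (count P?) (m+[n∸m]≡n M≤N) ⟩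
  count P? N                                   ∎
  where open ≤-Reasoning

count-∪ : (P? : Decidable P) (Q? : Decidable Q) → ∀ N →
          count (P? ∪? Q?) N ≤ count P? N + count Q? N
count-∪ P? Q? zero = z≤n
count-∪ P? Q? (suc N) with P? 0 | Q? 0
... | yes _ | yes _ = s≤s (≤-trans (count-∪ (P? ∘ suc) (Q? ∘ suc) N) (+-monoʳ-≤ (count (P? ∘ suc) N) (n≤1+n _)))
... | yes _ | no _  = s≤s (count-∪ (P? ∘ suc) (Q? ∘ suc) N)
... | no _  | yes _ = ≤-trans (s≤s (count-∪ (P? ∘ suc) (Q? ∘ suc) N)) (≤-reflexive (sym (+-suc _ _)))
... | no _  | no _  = count-∪ (P? ∘ suc) (Q? ∘ suc) N

count-shift : (P? : Decidable P) → ∀ a N → count (P? ∘ (a +_)) N ≤ count P? (a + N)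
count-shift P? a N = ≤-trans (m≤n+m _ _) (≤-reflexive (sym (count-+ P? a N)))

count-unshift : (P? : Decidable P) → ∀ a N → count (λ j → a ≤? j ×-dec P? (j ∸ a)) N ≤ count P? N
count-unshift {P = P} P? a N = begin
  count U? N                             ≤⟨ count-monoʳ-≤ U? (m≤n+m N a) ⟩
  count U? (a + N)                       ≡⟨ count-+ U? a N ⟩
  count U? a + count (U? ∘ (a +_)) N     ≡⟨ cong (_+ count (U? ∘ (a +_)) N) (count-none U? a (λ i<a (a≤i , _) → <⇒≱ i<a a≤i)) ⟩
  count (U? ∘ (a +_)) N                  ≤⟨ count-mono-⊆ (U? ∘ (a +_)) P? N (λ _ (_ , P[a+i∸a]) → subst P (m+n∸m≡n a _) P[a+i∸a]) ⟩
  count P? N                             ∎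
  where
  open ≤-Reasoning
  U? = λ j → a ≤? j ×-dec P? (j ∸ a)

count<⇒empty-block : (P? : Decidable P) → ∀ M q → count P? (M * q) < M →
                     ∃ λ m → m < M × (∀ {i} → i < q → ¬ P (m * q + i))
count<⇒empty-block {P = P} P? (suc M) q lt with count P? q in eq
... | zero  = 0 , z<s , count≡0⇒none P? q eq
... | suc c with count<⇒empty-block (P? ∘ (q +_)) M q rest<M
  where
  rest<M : count (P? ∘ (q +_)) (M * q) < M
  rest<M = ≤-pred (begin-strict
    suc (count (P? ∘ (q +_)) (M * q))         ≤⟨ s≤s (m≤n+m _ c) ⟩
    suc c + count (P? ∘ (q +_)) (M * q)       ≡⟨ cong (_+ count (P? ∘ (q +_)) (M * q)) eq ⟨
    count P? q + count (P? ∘ (q +_)) (M * q)  ≡⟨ count-+ P? q (M * q) ⟨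
    count P? (suc M * q)                      <⟨ lt ⟩
    suc M                                     ∎)
    where open ≤-Reasoning
... | m , m<M , empty = suc m , s<s m<M , λ {i} i<q → empty i<q ∘ subst P (+-assoc q (m * q) i)

count-cover : (P? : Decidable P) {Q : ℕ → Pred ℕ ℓ′} (Q? : ∀ c → Decidable (Q c)) → ∀ C N b →
              (∀ {j} → j < N → P j → ∃ λ c → c < C × Q c j) →
              (∀ {c} → c < C → count (Q? c) N ≤ b) →
              count P? N ≤ C * b
count-cover P? Q? zero N b cover _ =
  ≤-reflexive (count-none P? N (λ j<N Pj → case cover j<N Pj of λ ()))
count-cover {P = P} P? {Q} Q? (suc C) N b cover bound = begin
  count P? N                        ≤⟨ count-mono-⊆ P? (Q? C ∪? R?) N split ⟩
  count (Q? C ∪? R?) N              ≤⟨ count-∪ (Q? C) R? N ⟩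
  count (Q? C) N + count R? N       ≤⟨ +-mono-≤ (bound ≤-refl) (count-cover R? Q? C N b (λ _ Rj → Rj) (bound ∘ m≤n⇒m≤1+n)) ⟩
  b + C * b                         ∎
  where
  open ≤-Reasoning
  R : Pred ℕ _
  R j = ∃ λ c → c < C × Q c j
  R? : Decidable R
  R? j = anyUpTo? (λ c → Q? c j) C
  split : ∀ {j} → j < N → P j → (Q C ∪ R) j
  split j<N Pj with cover j<N Pj
  ... | c , c<1+C , Qcj with m≤n⇒m<n∨m≡n (≤-pred c<1+C)
  ...   | inj₁ c<C = inj₂ (c , c<C , Qcj)
  ...   | inj₂ refl = inj₁ Qcj

count-supported : (P? : Decidable P) → ∀ {x} → (∀ {t} → P t → t < x) → ∀ N → count P? N ≤ count P? x
count-supported P? {x} P<x N with ≤-total N x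
... | inj₁ N≤x = count-monoʳ-≤ P? N≤x
... | inj₂ x≤N = begin
  count P? N                                  ≡⟨ cong (count P?) (m+[n∸m]≡n x≤N) ⟨
  count P? (x + (N ∸ x))                      ≡⟨ count-+ P? x (N ∸ x) ⟩
  count P? x + count (P? ∘ (x +_)) (N ∸ x)    ≡⟨ cong (count P? x +_) (count-none (P? ∘ (x +_)) (N ∸ x) (λ _ → m+n≮m x _ ∘ P<x)) ⟩
  count P? x + 0                              ≡⟨ +-identityʳ _ ⟩
  count P? x                                  ∎
  where open ≤-Reasoning

gcd[m,m+n]≡gcd[m,n] : ∀ m n → gcd m (m + n) ≡ gcd m n
gcd[m,m+n]≡gcd[m,n] m n = GCD.GCD.unique (gcd-GCD m (m + n)) (GCD.GCD.step (gcd-GCD m n))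

module _ {a} {A : Set a} (g : ℕ → A) where

  IsPeriod : ℕ → ℕ → Set a
  IsPeriod L r = ∀ {i} → r + i < L → g i ≡ g (r + i)

  period-+ : ∀ {L p r} → p + (p + r) ≤ L → IsPeriod L p → IsPeriod L (p + r) → IsPeriod L r
  period-+ {L} {p} {r} bound Pp Pp+r {i} r+i<L with p ≤? i
  ... | yes p≤i with i′ , refl ← m≤n⇒∃[o]m+o≡n p≤i = begin
    g (p + i′)           ≡⟨ Pp (≤-<-trans (m≤n+m (p + i′) r) r+i<L) ⟨
    g i′                 ≡⟨ Pp+r (subst (_< L) (sym swap) r+i<L) ⟩
    g (p + r + i′)       ≡⟨ cong g swap ⟩
    g (r + (p + i′))     ∎
    where
    open ≡-Reasoning
    swap : p + r + i′ ≡ r + (p + i′)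
    swap = trans (cong (_+ i′) (+-comm p r)) (+-assoc r p i′)
  ... | no p≰i = begin
    g i                  ≡⟨ Pp+r q+i<L ⟩
    g (p + r + i)        ≡⟨ cong g (+-assoc p r i) ⟩
    g (p + (r + i))      ≡⟨ Pp (subst (_< L) (+-assoc p r i) q+i<L) ⟨
    g (r + i)            ∎
    where
    open ≡-Reasoning
    q+i<L : p + r + i < L
    q+i<L = <-≤-trans (+-monoʳ-< (p + r) (≰⇒> p≰i)) (subst (_≤ L) (+-comm p (p + r)) bound)

  period-gcd : ∀ {L} p q → p + q ≤ L → IsPeriod L p → IsPeriod L q → IsPeriod L (gcd p q)
  period-gcd {L} p q = go p q (<-wellFounded (p + q))
    where
    go : ∀ p q → Acc _<_ (p + q) → p + q ≤ L → IsPeriod L p → IsPeriod L q → IsPeriod L (gcd p q)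
    go zero        q        _        _     _  Pq = subst (IsPeriod L) (sym (gcd-identityˡ q)) Pq
    go p@(suc _)   zero     _        _     Pp _  = subst (IsPeriod L) (sym (gcd-identityʳ p)) Pp
    go p@(suc _)   q@(suc _) (acc rs) bound Pp Pq with ≤-total p q
    ... | inj₁ p≤q with r , refl ← m≤n⇒∃[o]m+o≡n p≤q =
      subst (IsPeriod L) (sym (gcd[m,m+n]≡gcd[m,n] p r))
        (go p r (rs (m<n+m (p + r) z<s)) (≤-trans (m≤n+m (p + r) p) bound) Pp (period-+ bound Pp Pq))
    ... | inj₂ q≤p with r , refl ← m≤n⇒∃[o]m+o≡n q≤p =
      subst (IsPeriod L) (sym (trans (gcd-comm (q + r) q) (gcd[m,m+n]≡gcd[m,n] q r)))
        (go q r (rs (m<m+n (q + r) z<s)) (≤-trans (m≤m+n (q + r) q) bound) Pq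
            (period-+ (subst (_≤ L) (+-comm (q + r) q) bound) Pq Pp))

gcd<m+n : ∀ {m n} → 0 < m → 0 < n → gcd m n < m + n
gcd<m+n {m@(suc _)} {n} 0<m 0<n = ≤-<-trans (∣⇒≤ (GCD.gcd[m,n]∣m m n)) (m<m+n m 0<n)

module _ {a} {A : Set a} (s : ℕ → A) where

  agree-at-gcd : ∀ {p q} y → 0 < p → 0 < q →
                 (∀ {i} → i < q → s (y + i) ≡ s (p + (y + i))) →
                 (∀ {i} → i < p → s (y + i) ≡ s (q + (y + i))) →
                 s y ≡ s (gcd p q + y)
  agree-at-gcd {p} {q} y 0<p 0<q p-agree q-agree = begin
    s y                    ≡⟨ cong s (+-identityʳ y) ⟨
    g 0                    ≡⟨ period-gcd g p q ≤-refl period-p period-q gcd+0<p+q ⟩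
    g (gcd p q + 0)        ≡⟨ cong s (trans (x∙yz≈y∙xz y (gcd p q) 0) (cong (gcd p q +_) (+-identityʳ y))) ⟩
    s (gcd p q + y)        ∎
    where
    open ≡-Reasoning
    g : ℕ → A
    g i = s (y + i)
    gcd+0<p+q : gcd p q + 0 < p + q
    gcd+0<p+q = subst (_< p + q) (sym (+-identityʳ _)) (gcd<m+n 0<p 0<q)
    period-p : IsPeriod g (p + q) p
    period-p {i} p+i<p+q = trans (p-agree (+-cancelˡ-< p i q p+i<p+q)) (cong s (x∙yz≈y∙xz p y i))
    period-q : IsPeriod g (p + q) q
    period-q {i} q+i<p+q =
      trans (q-agree (+-cancelˡ-< q i p (subst (q + i <_) (+-comm p q) q+i<p+q))) (cong s (x∙yz≈y∙xz q y i))

≢-split : ∀ {a} {A : Set a} → DecidableEquality A → {u v u′ v′ : A} →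
          u ≢ v → u′ ≡ v′ → u ≢ u′ ⊎ v ≢ v′
≢-split _≟_ {u} {v} {u′} {v′} u≢v u′≡v′ with u ≟ u′ | v ≟ v′
... | yes u≡u′ | yes v≡v′ = contradiction (trans u≡u′ (trans u′≡v′ (sym v≡v′))) u≢v
... | no  u≢u′ | _        = inj₁ u≢u′
... | yes _    | no v≢v′  = inj₂ v≢v′

[1+m+e]*q+j≡[1+e]*q+[m*q+j] : ∀ m e q j → (suc m + e) * q + j ≡ suc e * q + (m * q + j)
[1+m+e]*q+j≡[1+e]*q+[m*q+j] = solve-∀

module _ {a} {A : Set a} (_≟_ : DecidableEquality A) (s : ℕ → A) where

  Mismatch : ℕ → Pred ℕ a
  Mismatch r t = s t ≢ s (r + t)

  mismatch? : ∀ r → Decidable (Mismatch r)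
  mismatch? r t = ¬? (s t ≟ s (r + t))

  mismatch-along-progression : ∀ q m t → s t ≢ s (m * q + t) → ∃ λ i → i < m × Mismatch q (i * q + t)
  mismatch-along-progression q zero    t t≢t = contradiction refl t≢t
  mismatch-along-progression q (suc m) t t≢end with s (m * q + t) ≟ s (q + (m * q + t))
  ... | no last-step = m , ≤-refl , last-step
  ... | yes last-agree with mismatch-along-progression q m t t≢mid
    where
    t≢mid : s t ≢ s (m * q + t)
    t≢mid t≡mid = t≢end (trans t≡mid (trans last-agree (cong s (sym (+-assoc q (m * q) t)))))
  ...   | i , i<m , step = i , m≤n⇒m≤1+n i<m , step

  module _ (x p q k : ℕ) (0<p : 0 < p) (p<q : p < q)
           (few-p : count (mismatch? p) x ≤ k) (few-q : count (mismatch? q) x ≤ k) where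

    Bad : ℕ → Pred ℕ a
    Bad r t = t < x × Mismatch r t

    bad? : ∀ r → Decidable (Bad r)
    bad? r t = t <? x ×-dec mismatch? r t

    few-bad : ∀ {r} → count (mismatch? r) x ≤ k → ∀ N → count (bad? r) N ≤ k
    few-bad {r} few N = begin
      count (bad? r) N       ≤⟨ count-supported (bad? r) proj₁ N ⟩
      count (bad? r) x       ≤⟨ count-mono-⊆ (bad? r) (mismatch? r) x (λ _ → proj₂) ⟩
      count (mismatch? r) x  ≤⟨ few ⟩
      k                      ∎
      where open ≤-Reasoning

    d : ℕ
    d = gcd p q

    K : ℕ
    K = suc (k + k)

    d<q : d < q
    d<q = ≤-<-trans (∣⇒≤ {{>-nonZero 0<p}} (GCD.gcd[m,n]∣m p q)) p<q

    Clean : ℕ → Set a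
    Clean y = ∀ {i} → i < q → ¬ (Bad p ∪ Bad q) (y + i)

    clean-block : ∀ b → b + K * q ≤ x → ∃ λ m → m < K × Clean (m * q + b)
    clean-block b bound with count<⇒empty-block ((bad? p ∪? bad? q) ∘ (b +_)) K q few
      where
      few : count ((bad? p ∪? bad? q) ∘ (b +_)) (K * q) < K
      few = begin-strict
        count ((bad? p ∪? bad? q) ∘ (b +_)) (K * q)   ≤⟨ count-shift (bad? p ∪? bad? q) b (K * q) ⟩
        count (bad? p ∪? bad? q) (b + K * q)          ≤⟨ count-∪ (bad? p) (bad? q) (b + K * q) ⟩
        count (bad? p) (b + K * q) + count (bad? q) (b + K * q)
          ≤⟨ +-mono-≤ (few-bad few-p (b + K * q)) (few-bad few-q (b + K * q)) ⟩
        k + k                                         <⟨ ≤-refl ⟩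
        K                                             ∎
        where open ≤-Reasoning
    ... | m , m<K , empty = m , m<K , λ {i} i<q → empty i<q ∘ subst (Bad p ∪ Bad q) (trans (+-assoc (m * q) b i) (x∙yz≈y∙xz (m * q) b i))

    clean⇒agree : ∀ y → Clean y → y + q ≤ x → s y ≡ s (d + y)
    clean⇒agree y clean y+q≤x =
      agree-at-gcd s y 0<p (<-trans 0<p p<q) (agree p inj₁) (λ i<p → agree q inj₂ (<-trans i<p p<q))
      where
      agree : ∀ r {i} → (Bad r (y + i) → (Bad p ∪ Bad q) (y + i)) → i < q → s (y + i) ≡ s (r + (y + i))
      agree r bad⇒ i<q = decidable-stable (s _ ≟ s _) (λ mis → clean i<q (bad⇒ (<-≤-trans (+-monoʳ-< y i<q) y+q≤x , mis)))

    Near : ℕ → Pred ℕ a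
    Near c = (Bad q ∘ (c * q +_)) ∪ (λ t → c * q ≤ t × Bad q (t ∸ c * q))

    near? : ∀ c → Decidable (Near c)
    near? c = (bad? q ∘ (c * q +_)) ∪? (λ t → c * q ≤? t ×-dec bad? q (t ∸ c * q))

    -- a d-mismatch at j gets charged to a q-mismatch at distance c·q from j or from d + j
    Charged : ℕ → Pred ℕ a
    Charged c = Near c ∪ (Near c ∘ (d +_))

    charged? : ∀ c → Decidable (Charged c)
    charged? c = near? c ∪? (near? c ∘ (d +_))

    count-near : ∀ c N → count (near? c) N ≤ k + k
    count-near c N = begin
      count (near? c) N                                 ≤⟨ count-∪ (bad? q ∘ (c * q +_)) _ N ⟩
      count (bad? q ∘ (c * q +_)) N + count (λ t → c * q ≤? t ×-dec bad? q (t ∸ c * q)) N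
        ≤⟨ +-mono-≤ (count-shift (bad? q) (c * q) N) (count-unshift (bad? q) (c * q) N) ⟩
      count (bad? q) (c * q + N) + count (bad? q) N     ≤⟨ +-mono-≤ (few-bad few-q (c * q + N)) (few-bad few-q N) ⟩
      k + k                                             ∎
      where open ≤-Reasoning

    count-charged : ∀ c N → count (charged? c) N ≤ (k + k) + (k + k)
    count-charged c N = ≤-trans (count-∪ (near? c) (near? c ∘ (d +_)) N)
                                (+-mono-≤ (count-near c N) (≤-trans (count-shift (near? c) d N) (count-near c (d + N))))

    bad-along-progression : ∀ m t → m * q + t < x + q → s t ≢ s (m * q + t) → ∃ λ i → i < m × Bad q (i * q + t)
    bad-along-progression m t end<x+q t≢end with mismatch-along-progression q m t t≢end
    ... | i , i<m , mis = i , i<m , +-cancelˡ-< q _ x q+pos<q+x , mis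
      where
      q+pos<q+x : q + (i * q + t) < q + x
      q+pos<q+x = begin-strict
        q + (i * q + t)  ≡⟨ +-assoc q (i * q) t ⟨
        suc i * q + t    ≤⟨ +-monoˡ-≤ t (*-monoˡ-≤ q i<m) ⟩
        m * q + t        <⟨ end<x+q ⟩
        x + q            ≡⟨ +-comm x q ⟩
        q + x            ∎
        where open ≤-Reasoning

    near-below : ∀ c {i t} → Bad q (i * q + t) → Near c ((c + i) * q + t)
    near-below c {i} {t} bad = inj₂ (subst (λ u → c * q ≤ u × Bad q (u ∸ c * q)) (sym split)
                                          (m≤m+n (c * q) _ , subst (Bad q) (sym (m+n∸m≡n (c * q) _)) bad))
      where
      split : (c + i) * q + t ≡ c * q + (i * q + t)
      split = trans (cong (_+ t) (*-distribʳ-+ q c i)) (+-assoc (c * q) (i * q) t)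

    charge-below : ∀ m t → m * q + t < x + q → s t ≢ s (m * q + t) → ∃ λ c → c ≤ m × Near c (m * q + t)
    charge-below m t end<x+q t≢end with bad-along-progression m t end<x+q t≢end
    ... | i , i<m , bad with c , i+c≡m ← m≤n⇒∃[o]m+o≡n (<⇒≤ i<m) =
      c , subst (c ≤_) i+c≡m (m≤n+m c i) ,
      subst (λ n → Near c (n * q + t)) (trans (+-comm c i) i+c≡m) (near-below c bad)

    agree-after : ∀ b → b + K * q ≤ x → ∃ λ m → m < K × m * q + b ≤ x × s (m * q + b) ≡ s (d + (m * q + b))
    agree-after b bound with clean-block b bound
    ... | m , m<K , clean = m , m<K , ≤-trans (m≤m+n _ q) block-end , clean⇒agree (m * q + b) clean block-end
      where
      block-end : m * q + b + q ≤ x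
      block-end = begin
        m * q + b + q    ≡⟨ trans (+-assoc (m * q) b q) (trans (x∙yz≈y∙xz (m * q) b q) (cong (b +_) (+-comm (m * q) q))) ⟩
        b + suc m * q    ≤⟨ +-monoʳ-≤ b (*-monoˡ-≤ q m<K) ⟩
        b + K * q        ≤⟨ bound ⟩
        x                ∎
        where open ≤-Reasoning

    charge-forward : ∀ {m j} → m * q + j ≤ x → Mismatch d j → s (m * q + j) ≡ s (d + (m * q + j)) →
                     ∃ λ c → c < m × Charged c j
    charge-forward {m} {j} y≤x j-mis agree with ≢-split _≟_ j-mis agree
    ... | inj₁ j≢y = let c , c<m , bad = bad-along-progression m j y<x+q j≢y in c , c<m , inj₁ (inj₁ bad)
      where
      y<x+q : m * q + j < x + q
      y<x+q = <-≤-trans (m<m+n (m * q + j) (<-trans 0<p p<q)) (+-monoˡ-≤ q y≤x)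
    ... | inj₂ dj≢dy =
      let c , c<m , bad = bad-along-progression m (d + j) dy<x+q (dj≢dy ∘ (λ eq → trans eq (cong s (x∙yz≈y∙xz (m * q) d j))))
      in  c , c<m , inj₂ (inj₁ bad)
      where
      dy<x+q : m * q + (d + j) < x + q
      dy<x+q = begin-strict
        m * q + (d + j)  ≡⟨ trans (x∙yz≈y∙xz (m * q) d j) (+-comm d _) ⟩
        m * q + j + d    <⟨ +-mono-≤-< y≤x d<q ⟩
        x + q            ∎
        where open ≤-Reasoning

    charge-backward : ∀ {m y} → m * q + y < x → Mismatch d (m * q + y) → s y ≡ s (d + y) →
                      ∃ λ c → c ≤ m × Charged c (m * q + y)
    charge-backward {m} {y} j<x j-mis agree with ≢-split _≟_ j-mis agree
    ... | inj₁ j≢y =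
      let c , c≤m , near = charge-below m y (<-≤-trans j<x (m≤m+n x q)) (j≢y ∘ sym)
      in  c , c≤m , inj₁ near
    ... | inj₂ dj≢dy =
      let c , c≤m , near = charge-below m (d + y) dj<x+q (dj≢dy ∘ sym ∘ (λ eq → trans eq (cong s dj≡)))
      in  c , c≤m , inj₂ (subst (Near c) dj≡ near)
      where
      dj≡ : m * q + (d + y) ≡ d + (m * q + y)
      dj≡ = x∙yz≈y∙xz (m * q) d y
      dj<x+q : m * q + (d + y) < x + q
      dj<x+q = subst (_< x + q) (trans (+-comm _ d) (sym dj≡)) (+-mono-< j<x d<q)

    charge-up : ∀ {j} → j + K * q ≤ x → Mismatch d j → ∃ λ c → c < K × Charged c j
    charge-up {j} bound j-mis =
      let m , m<K , y≤x , agree = agree-after j bound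
          c , c<m , charged = charge-forward y≤x j-mis agree
      in  c , <-trans c<m m<K , charged

    charge-down : ∀ {j′} → K * q + j′ < x → Mismatch d (K * q + j′) → ∃ λ c → c ≤ K × Charged c (K * q + j′)
    charge-down {j′} j<x j-mis =
      let m , m<K , _ , agree = agree-after j′ (subst (_≤ x) (+-comm (K * q) j′) (<⇒≤ j<x))
          e , 1+m+e≡K = m≤n⇒∃[o]m+o≡n m<K
          j≡ = trans (cong (λ n → n * q + j′) (sym 1+m+e≡K)) ([1+m+e]*q+j≡[1+e]*q+[m*q+j] m e q j′)
          c , c≤1+e , charged = charge-backward (subst (_< x) j≡ j<x) (subst (Mismatch d) j≡ j-mis) agree
      in  c , ≤-trans c≤1+e (subst (suc e ≤_) 1+m+e≡K (s≤s (m≤n+m e m))) , subst (Charged c) (sym j≡) charged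

    charge : K * q + K * q ≤ x → ∀ {j} → j < x → Mismatch d j → ∃ λ c → c < suc K × Charged c j
    -- K blocks of length q fit after j, or else (as x ≥ 2Kq) before it
    charge room {j} j<x j-mis with j + K * q ≤? x
    ... | yes bound = let c , c<K , charged = charge-up bound j-mis in c , m<n⇒m<1+n c<K , charged
    ... | no j+Kq≰x with j′ , refl ← m≤n⇒∃[o]m+o≡n (<⇒≤ (+-cancelʳ-< (K * q) (K * q) j (≤-<-trans room (≰⇒> j+Kq≰x)))) =
      let c , c≤K , charged = charge-down j<x j-mis in c , s≤s c≤K , charged

    count-mismatch-gcd : K * q + K * q ≤ x → count (mismatch? d) x ≤ suc K * ((k + k) + (k + k))
    count-mismatch-gcd room = count-cover (mismatch? d) charged? (suc K) x _ (charge room) (λ {c} _ → count-charged c x)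

module _ {A : Set} where

  -- positions ≥ n read as a₀; the Hamming distances below only look at positions < n
  lookupOr : ∀ {n} → A → Vec A n → ℕ → A
  lookupOr {n} a₀ S t with t <? n
  ... | yes t<n = lookup S (fromℕ< t<n)
  ... | no  _   = a₀

  lookup≡lookupOr : ∀ {n} a₀ (S : Vec A n) {t} (t<n : t < n) → lookup S (fromℕ< t<n) ≡ lookupOr a₀ S t
  lookup≡lookupOr {n} a₀ S {t} t<n with t <? n
  ... | yes t<n′ = cong (lookup S) (fromℕ<-cong t t refl t<n t<n′)
  ... | no  t≮n  = contradiction t<n t≮n

  substr≡tabulate : ∀ {n} a₀ (S : Vec A n) i len (h : i + len ≤ n) →
                    substr S i len h ≡ tabulate (λ j → lookupOr a₀ S (i + toℕ j))
  substr≡tabulate a₀ S i len h = tabulate-cong (λ j → lookup≡lookupOr a₀ S (<-≤-trans (+-monoʳ-< i (toℕ<n j)) h))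

  HAM-tabulate : (_≟_ : DecidableEquality A) → ∀ m (f g : ℕ → A) →
                 HAM _≟_ (tabulate {n = m} (f ∘ toℕ)) (tabulate (g ∘ toℕ)) ≡ count (λ j → ¬? (f j ≟ g j)) m
  HAM-tabulate _≟_ zero    f g = refl
  HAM-tabulate _≟_ (suc m) f g with f 0 ≟ g 0
  ... | yes _ = HAM-tabulate _≟_ m (f ∘ suc) (g ∘ suc)
  ... | no  _ = cong suc (HAM-tabulate _≟_ m (f ∘ suc) (g ∘ suc))

  HAM-substr : (_≟_ : DecidableEquality A) → ∀ {n} a₀ (S : Vec A n) x r (h₀ : 0 + x ≤ n) (h : r + x ≤ n) →
               HAM _≟_ (substr S 0 x h₀) (substr S r x h) ≡ count (mismatch? _≟_ (lookupOr a₀ S) r) x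
  HAM-substr _≟_ a₀ S x r h₀ h
    rewrite substr≡tabulate a₀ S 0 x h₀ | substr≡tabulate a₀ S r x h =
    HAM-tabulate _≟_ x (lookupOr a₀ S) (λ t → lookupOr a₀ S (r + t))

q*[4k+2]≡K*q+K*q : ∀ k q → q * (4 * k + 2) ≡ suc (k + k) * q + suc (k + k) * q
q*[4k+2]≡K*q+K*q = solve-∀

[2k+2]*[4k]≤16kk+1 : ∀ {k} → 1 ≤ k → suc (suc (k + k)) * ((k + k) + (k + k)) ≤ 16 * k * k + 1
[2k+2]*[4k]≤16kk+1 {suc k} _ = ≤-trans (m≤m+n _ (8 * k * suc k + 1)) (≤-reflexive (sym (slack k)))
  where
  slack : ∀ k → 16 * suc k * suc k + 1 ≡
                suc (suc (suc k + suc k)) * ((suc k + suc k) + (suc k + suc k)) + (8 * k * suc k + 1)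
  slack = solve-∀

mainTheorem8 : {A : Set} (_≟_ : DecidableEquality A) (n : ℕ) (S : Vec A n)
    (k x : ℕ) → 1 ≤ k → 1 ≤ x → 2 * x ≤ n → (h0 : 0 + x ≤ n) →
    (p q : ℕ) → 1 ≤ p → p * (4 * k + 2) ≤ x →
    (hp : p + x ≤ n) → HAM _≟_ (substr S 0 x h0) (substr S p x hp) ≤ k →
    1 ≤ q → q * (4 * k + 2) ≤ x →
    (hq : q + x ≤ n) → HAM _≟_ (substr S 0 x h0) (substr S q x hq) ≤ k →
    p < q →
    (hd : gcd p q + x ≤ n) →
    HAM _≟_ (substr S 0 x h0) (substr S (gcd p q) x hd) ≤ 16 * k * k + 1
mainTheorem8 _≟_ n S k x 1≤k 1≤x _ h0 p q 1≤p _ hp few-p _ q-short hq few-q p<q hd = begin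
  HAM _≟_ (substr S 0 x h0) (substr S (gcd p q) x hd)  ≡⟨ HAM-substr _≟_ a₀ S x (gcd p q) h0 hd ⟩
  count (mismatch? _≟_ s (gcd p q)) x                  ≤⟨ count-mismatch-gcd _≟_ s x p q k 1≤p p<q
                                                            (subst (_≤ k) (HAM-substr _≟_ a₀ S x p h0 hp) few-p)
                                                            (subst (_≤ k) (HAM-substr _≟_ a₀ S x q h0 hq) few-q)
                                                            (subst (_≤ x) (q*[4k+2]≡K*q+K*q k q) q-short) ⟩
  suc (suc (k + k)) * ((k + k) + (k + k))              ≤⟨ [2k+2]*[4k]≤16kk+1 1≤k ⟩
  16 * k * k + 1                                       ∎
  where
  open ≤-Reasoning
  a₀ = lookup S (fromℕ< (≤-trans 1≤x h0))
  s = lookupOr a₀ S
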